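{- Let $N>2$ and $b\geq 2$ be integers, let $\Phi_N(x)$ denote the $N$-th cyclotomic polynomial, and put \[ f_N(b)=\frac{\Phi_N(b)}{\gcd\left(N,\ \Phi_N(b)\right)}. \] If $f_N(b)$ is composite, then $f_N(b)$ is a Midy's number to base $b$.
   Context: For coprime positive integers $M,b$, $|b|_M$ denotes the multiplicative order of $b$ modulo $M$, and $\mathbb{U}_M$ is the group of positive integers less than $M$ and coprime to $M$. Midy's property: let $|b|_M=kd$ with $d>1$, and for $x\in\mathbb{U}_M$ write $x/M=0.\overline{a_1a_2\cdots a_{|b|_M}}$ in base $b$ (the bar marks the period, of length $|b|_M$). Split the period into $d$ blocks of length $k$, let $A_j=[a_{(j-1)k+1}\cdots a_{jk}]_b$ be the number written in base $b$ by the $j$-th block, and $S_d(x)=\sum_{j=1}^d A_j$. $M$ has the Midy's property for $b$ and $d$ if $b^k-1$ divides $S_d(x)$ for every $x\in\mathbb{U}_M$; $\mathcal{M}_b(M)$ is the set of divisors $d$ of $|b|_M$ for which this holds. A Midy's number (overpseudoprime) to base $b$ is an odd composite number $M$ coprime to both $b$ and $|b|_M$ such that every divisor $d>1$ of $|b|_M$ lies in $\mathcal{M}_b(M)$. (It is known that an odd composite $M$ coprime to $b$ is a Midy's number to base $b$ if and only if $|b|_M=|b|_p$ for every prime $p$ dividing $M$.) -}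

module Defs where

open import Data.Nat using (ℕ; zero; suc; _+_; _*_; _∸_; _^_; _≤_; _<_; _/_; _%_)
open import Data.Nat.Divisibility using (_∣_; _∣?_)
open import Data.Nat.Coprimality using (Coprime)
open import Data.Nat.Primality using (Composite)
open import Data.List using (List; []; _∷_; map; upTo; filter)
open import Data.Nat.ListAction using (sum)
open import Data.Product using (_×_; ∃-syntax)
open import Relation.Nullary using (¬_)

-- total division / remainder (value 0 for divisor 0; only used with nonzero divisors)
_/′_ : ℕ → ℕ → ℕ
m /′ zero = 0
m /′ suc n = m / suc n

_%′_ : ℕ → ℕ → ℕ
m %′ zero = m
m %′ suc n = m % suc n

range1 : ℕ → List ℕ
range1 n = map suc (upTo n)

-- Cyclotomic polynomial evaluated at b, via the defining recursion
--   b^N - 1 = ∏_{d ∣ N} Φ_d(b),  i.e.  Φ_N(b) = (b^N - 1) / ∏_{d ∣ N, d < N} Φ_d(b).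
-- (first argument is fuel; fuel ≥ N suffices)
mutual
  cycF : ℕ → ℕ → ℕ → ℕ
  cycF zero N b = 1
  cycF (suc f) N b = (b ^ N ∸ 1) /′ prodCyc f b (filter (_∣? N) (range1 (N ∸ 1)))

  prodCyc : ℕ → ℕ → List ℕ → ℕ
  prodCyc f b [] = 1
  prodCyc f b (d ∷ ds) = cycF f d b * prodCyc f b ds

Φ : ℕ → ℕ → ℕ
Φ N b = cycF N N b

open import Data.Nat.GCD using (gcd)

fN : ℕ → ℕ → ℕ
fN N b = Φ N b /′ gcd N (Φ N b)

IsOrder : ℕ → ℕ → ℕ → Set
IsOrder b M n = (0 < n) × (M ∣ (b ^ n ∸ 1))
              × (∀ m → 0 < m → m < n → ¬ (M ∣ (b ^ m ∸ 1)))

-- i-th base-b digit (i ≥ 1) after the point of x/M : a_i = ⌊x b^i / M⌋ mod b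
digit : ℕ → ℕ → ℕ → ℕ → ℕ
digit b M x i = ((x * b ^ i) /′ M) %′ b

-- A_j (j ≥ 1): the number written in base b by the digits a_{(j-1)k+1} … a_{jk}
block : ℕ → ℕ → ℕ → ℕ → ℕ → ℕ
block b M x k j = sum (map (λ t → digit b M x ((j ∸ 1) * k + t) * b ^ (k ∸ t)) (range1 k))

S : ℕ → ℕ → ℕ → ℕ → ℕ → ℕ
S b M x k d = sum (map (block b M x k) (range1 d))

HasMidy : ℕ → ℕ → ℕ → ℕ → Set
HasMidy b M ord d = ∀ k → k * d ≡ ord →
  ∀ x → 0 < x → x < M → Coprime x M → (b ^ k ∸ 1) ∣ S b M x k d
  where open import Relation.Binary.PropositionalEquality using (_≡_)

MidyNumber : ℕ → ℕ → Set
MidyNumber b M = ¬ (2 ∣ M) × Composite M × Coprime M b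
  × ∃[ ord ] (IsOrder b M ord × Coprime M ord
              × (∀ d → d ∣ ord → 1 < d → HasMidy b M ord d))

-- Write F n = b^n - 1. The recursion defining Φ_N(b) is an exact division: by strong
-- induction, the p-adic valuation of ∏_{d ∣ N, d < N} Φ_d(b) is, by inclusion–exclusion over
-- the proper divisors x of N and v_p(F (gcd x y)) = min (v_p(F x), v_p(F y)), the largest
-- v_p(F x), which is at most v_p(F N). Hence ∏_{d ∣ N} Φ_d(b) = F N, and Φ_{n′q}(b) divides
-- 1 + c + … + c^(q-1) with c = b^n′.
--
-- Let a prime p divide Φ_N(b) and F k for some k < N. Then p ∣ F e for the proper divisor
-- e = gcd k N; writing N = n′ q with e ∣ n′ and q prime, the congruence c ≡ 1 (mod p) forces
-- p = q, and a computation modulo p² shows p² ∤ Φ_N(b). So no prime factor of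
-- M = f_N(b) divides F k for 0 < k < N. As every prime p ∤ b divides some F k with k < p,
-- every prime factor of M exceeds N: M is odd and prime to N, b has order N modulo M, and for
-- N = k d the coprimality of M and F k gives M ∣ 1 + b^k + … + b^(k(d-1)), which yields
-- Midy's property since S_d(x) ≡ ⌊x b^N / M⌋ (mod b^k - 1).

module Submission where

open import Data.Bool using (Bool; true; false; if_then_else_; _∧_; _∨_; not)
open import Data.Bool.Properties using (∧-distribˡ-∨; ∨-zeroʳ; ∧-zeroʳ)
open import Data.Empty using (⊥; ⊥-elim)
open import Data.Fin using (toℕ; fromℕ<)
open import Data.Fin.Properties using (pigeonhole; toℕ<n; toℕ-fromℕ<)
open import Data.List using (List; []; _∷_; _++_; map; filter; upTo; length; foldr)
open import Data.Bool.ListAction using (any)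
open import Data.List.Properties using (length-map; filter-++; map-++; upTo-∷ʳ; map-cong; map-∘; map-applyUpTo)
open import Data.List.Relation.Unary.All using (All; []; _∷_)
open import Data.Nat
open import Data.Nat.Properties
open import Data.Nat.Coprimality using (Coprime; coprime-divisor)
open import Data.Nat.Divisibility
open import Data.Nat.DivMod
open import Data.Nat.GCD
open import Data.Nat.Induction using (<-wellFounded)
open import Data.Nat.ListAction using (sum; product)
open import Data.Nat.Primality
open import Data.Nat.Primality.Factorisation using (factorise)
open import Data.Nat.Tactic.RingSolver using (solve-∀)
open import Data.Product using (_×_; _,_; proj₁; proj₂; ∃-syntax)
open import Data.Sum using (_⊎_; inj₁; inj₂; [_,_]′)
open import Function using (id)
open import Induction.WellFounded using (Acc; acc)
open import Relation.Binary using (tri<; tri≈; tri>)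
open import Relation.Binary.PropositionalEquality
open import Relation.Nullary using (¬_; yes; no; does)
open import Relation.Nullary.Decidable using (dec-true; dec-false)
open import Defs

prime⇒≥2 : ∀ {p} → Prime p → 2 ≤ p
prime⇒≥2 {p} pr = nonTrivial⇒n>1 p {{prime⇒nonTrivial pr}}

prime-divisor : ∀ n → 2 ≤ n → ∃[ p ] (Prime p × p ∣ n)
prime-divisor (suc n) 2≤n with factorise (suc n)
... | record { factors = [] ; isFactorisation = eq } = ⊥-elim (<-irrefl (sym eq) 2≤n)
... | record { factors = p ∷ ps ; isFactorisation = eq ; factorsPrime = pr ∷ _ } =
  p , pr , divides (product ps) (trans eq (*-comm p (product ps)))

primes-equal : ∀ {p q} → Prime p → Prime q → p ∣ q → p ≡ q
primes-equal pp pq p∣q with prime⇒irreducible pq p∣q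
... | inj₁ refl = ⊥-elim (<-irrefl refl (prime⇒≥2 pp))
... | inj₂ eq = eq

coprime-by-primes : ∀ m n → 0 < m → (∀ p → Prime p → p ∣ m → ¬ p ∣ n) → Coprime m n
coprime-by-primes m n 0<m h {zero} (0∣m , _) = ⊥-elim (<-irrefl (sym (0∣⇒≡0 0∣m)) 0<m)
coprime-by-primes m n 0<m h {1} _ = refl
coprime-by-primes m n 0<m h {suc (suc i)} (i∣m , i∣n) with prime-divisor (suc (suc i)) (s≤s (s≤s z≤n))
... | p , pr , p∣i = ⊥-elim (h p pr (∣-trans p∣i i∣m) (∣-trans p∣i i∣n))

even⊎odd : ∀ n → (∃[ h ] n ≡ h * 2) ⊎ (∃[ h ] n ≡ suc (h * 2))
even⊎odd zero = inj₁ (0 , refl)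
even⊎odd (suc n) with even⊎odd n
... | inj₁ (h , refl) = inj₂ (h , refl)
... | inj₂ (h , refl) = inj₁ (suc h , refl)

odd≢even : ∀ h k → suc (h * 2) ≢ k * 2
odd≢even zero (suc k) ()
odd≢even (suc h) (suc k) eq = odd≢even h k (suc-injective (suc-injective eq))

¬2∣odd : ∀ h → ¬ 2 ∣ suc (h * 2)
¬2∣odd h (divides k eq) = odd≢even h k eq

*>0⇒ˡ>0 : ∀ m n → 0 < m * n → 0 < m
*>0⇒ˡ>0 (suc m) n _ = s≤s z≤n

*>0⇒ʳ>0 : ∀ m n → 0 < m * n → 0 < n
*>0⇒ʳ>0 m n 0<mn = *>0⇒ˡ>0 n m (subst (0 <_) (*-comm m n) 0<mn)

%-≡⇒∣∸ : ∀ m n d .{{_ : NonZero d}} → m % d ≡ n % d → d ∣ m ∸ n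
%-≡⇒∣∸ m n d m%d≡n%d = divides (m / d ∸ n / d) (begin
    m ∸ n                                         ≡⟨ cong₂ _∸_ (m≡m%n+[m/n]*n m d) (m≡m%n+[m/n]*n n d) ⟩
    (m % d + m / d * d) ∸ (n % d + n / d * d)     ≡⟨ cong (λ r → (r + m / d * d) ∸ (n % d + n / d * d)) m%d≡n%d ⟩
    (n % d + m / d * d) ∸ (n % d + n / d * d)     ≡⟨ [m+n]∸[m+o]≡n∸o (n % d) _ _ ⟩
    m / d * d ∸ n / d * d                         ≡⟨ sym (*-distribʳ-∸ d (m / d) (n / d)) ⟩
    (m / d ∸ n / d) * d                           ∎)
  where open ≡-Reasoning

m*[n/′m]≡n : ∀ m n → 0 < m → m ∣ n → m * (n /′ m) ≡ n
m*[n/′m]≡n (suc m) n _ m∣n = m*[n/m]≡n m∣n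

_∣ᵇ_ : ℕ → ℕ → Bool
d ∣ᵇ n = does (d ∣? n)

∣ᵇ-beyond : ∀ {x} d → 0 < x → x < d → d ∣ᵇ x ≡ false
∣ᵇ-beyond d 0<x x<d = dec-false (d ∣? _) (λ d∣x → <⇒≱ x<d (∣⇒≤ {{>-nonZero 0<x}} d∣x))

gcd>0 : ∀ m n → 0 < m → 0 < gcd m n
gcd>0 m n 0<m = n≢0⇒n>0 (gcd[m,n]≢0 m n (inj₁ (n>0⇒n≢0 0<m)))

repunit : ℕ → ℕ → ℕ
repunit c zero = 0
repunit c (suc k) = 1 + c * repunit c k

repunit-mod : ∀ p t q → ∃[ T ] repunit (1 + p * t) q ≡ q + p * T
repunit-mod p t zero = 0 , sym (*-zeroʳ p)
repunit-mod p t (suc q) with repunit-mod p t q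
... | T , eq = T + t * (q + p * T) , trans (cong (λ z → 1 + (1 + p * t) * z) eq) (lemma p t q T)
  where
  lemma : ∀ p t q T → 1 + (1 + p * t) * (q + p * T) ≡ suc q + p * (T + t * (q + p * T))
  lemma = solve-∀

triangle : ℕ → ℕ
triangle zero = 0
triangle (suc n) = triangle n + n

repunit-mod² : ∀ p t n → ∃[ W ] repunit (1 + p * t) n ≡ n + p * t * triangle n + p * p * W
repunit-mod² p t zero = 0 , lemma p t
  where
  lemma : ∀ p t → 0 ≡ 0 + p * t * 0 + p * p * 0
  lemma = solve-∀
repunit-mod² p t (suc n) with repunit-mod² p t n
... | W , eq = W + t * t * triangle n + p * t * W ,
               trans (cong (λ z → 1 + (1 + p * t) * z) eq) (lemma p t n (triangle n) W)
  where
  lemma : ∀ p t n T W → 1 + (1 + p * t) * (n + p * t * T + p * p * W) ≡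
                        suc n + p * t * (T + n) + p * p * (W + t * t * T + p * t * W)
  lemma = solve-∀

triangle-odd : ∀ h → triangle (suc (h * 2)) ≡ suc (h * 2) * h
triangle-odd zero = refl
triangle-odd (suc h) = trans (cong (λ z → z + suc (h * 2) + suc (suc (h * 2))) (triangle-odd h)) (lemma h)
  where
  lemma : ∀ h → suc (h * 2) * h + suc (h * 2) + suc (suc (h * 2)) ≡ suc (suc (suc (h * 2))) * suc h
  lemma = solve-∀

-- Modulo p², repunit (1 + p t) p ≡ p + p t (p choose 2), and p ∣ (p choose 2) since p is odd.
p²∤repunit-odd : ∀ h t → 0 < h → let p = suc (h * 2) in ¬ p * p ∣ repunit (1 + p * t) p
p²∤repunit-odd h t 0<h p²∣ with repunit-mod² (suc (h * 2)) t (suc (h * 2))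
... | W , eq = <⇒≱ p<p² (∣⇒≤ p²∣p)
  where
  p = suc (h * 2)
  repunit≡ : repunit (1 + p * t) p ≡ p + p * p * (t * h + W)
  repunit≡ = trans eq (trans (cong (λ z → p + p * t * z + p * p * W) (triangle-odd h)) (lemma p t h W))
    where
    lemma : ∀ p t h W → p + p * t * (p * h) + p * p * W ≡ p + p * p * (t * h + W)
    lemma = solve-∀
  p²∣p : p * p ∣ p
  p²∣p = ∣m+n∣m⇒∣n (subst (p * p ∣_) (trans repunit≡ (+-comm p _)) p²∣) (∣m⇒∣m*n (t * h + W) ∣-refl)
  p<p² : p < p * p
  p<p² = m<m*n p p (s≤s (≤-trans (s≤s z≤n) (*-mono-≤ 0<h (≤-refl {2}))))

repunit[odd²,2] : ∀ t → repunit (suc (t * 2) ^ 2) 2 ≡ 2 + 4 * (t * t + t)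
repunit[odd²,2] t = lemma t
  where
  lemma : ∀ t → 1 + (suc (t * 2) * (suc (t * 2) * 1)) * (1 + (suc (t * 2) * (suc (t * 2) * 1)) * 0) ≡ 2 + 4 * (t * t + t)
  lemma = solve-∀

4∤2+4* : ∀ x → ¬ 4 ∣ 2 + 4 * x
4∤2+4* x 4∣ = <⇒≱ {2} {4} (s≤s (s≤s (s≤s z≤n))) (∣⇒≤ 4∣2)
  where
  4∣2 : 4 ∣ 2
  4∣2 = ∣m+n∣m⇒∣n (subst (4 ∣_) (+-comm 2 (4 * x)) 4∣) (∣m⇒∣m*n x ∣-refl)

module PowerMinusOne (B : ℕ) .{{_ : NonZero B}} where

  F : ℕ → ℕ
  F n = B ^ n ∸ 1

  B^≡1+F : ∀ n → B ^ n ≡ suc (F n)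
  B^≡1+F n = sym (m+[n∸m]≡n (m^n>0 B n))

  F-+ : ∀ m n → F (m + n) ≡ B ^ m * F n + F m
  F-+ m n = suc-injective (begin
      suc (F (m + n))         ≡⟨ sym (B^≡1+F (m + n)) ⟩
      B ^ (m + n)             ≡⟨ ^-distribˡ-+-* B m n ⟩
      B ^ m * B ^ n           ≡⟨ cong (B ^ m *_) (B^≡1+F n) ⟩
      B ^ m * suc (F n)       ≡⟨ *-suc (B ^ m) (F n) ⟩
      B ^ m + B ^ m * F n     ≡⟨ cong (_+ B ^ m * F n) (B^≡1+F m) ⟩
      suc (F m + B ^ m * F n) ≡⟨ cong suc (+-comm (F m) (B ^ m * F n)) ⟩
      suc (B ^ m * F n + F m) ∎)
    where open ≡-Reasoning

  F-* : ∀ d k → F (d * k) ≡ F d * repunit (B ^ d) k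
  F-* d zero rewrite *-zeroʳ d | *-zeroʳ (F d) = refl
  F-* d (suc k) = begin
      F (d * suc k)                           ≡⟨ cong F (*-suc d k) ⟩
      F (d + d * k)                           ≡⟨ F-+ d (d * k) ⟩
      B ^ d * F (d * k) + F d                 ≡⟨ cong (λ z → B ^ d * z + F d) (F-* d k) ⟩
      B ^ d * (F d * repunit (B ^ d) k) + F d ≡⟨ lemma (B ^ d) (F d) (repunit (B ^ d) k) ⟩
      F d * repunit (B ^ d) (suc k)           ∎
    where
    open ≡-Reasoning
    lemma : ∀ x y z → x * (y * z) + y ≡ y * (1 + x * z)
    lemma = solve-∀

  F-mono-∣ : ∀ {d n} → d ∣ n → F d ∣ F n
  F-mono-∣ {d} (divides k refl) =
    divides (repunit (B ^ d) k) (trans (cong F (*-comm k d)) (trans (F-* d k) (*-comm (F d) _)))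

  ∣F-gcd : ∀ {c} m n → c ∣ F m → c ∣ F n → c ∣ F (gcd m n)
  ∣F-gcd {c} m n c∣Fm c∣Fn with Bézout.lemma m n
  ... | Bézout.result d g bézout with GCD.unique g (gcd-GCD m n)
  ... | refl with bézout
  ... | Bézout.+- x y eq = ∣m+n∣m⇒∣n c∣sum (∣n⇒∣m*n (B ^ d) (∣-trans c∣Fn (F-mono-∣ (divides y refl))))
    where
    c∣sum : c ∣ B ^ d * F (y * n) + F d
    c∣sum = subst (c ∣_) (F-+ d (y * n)) (subst (λ z → c ∣ F z) (sym eq) (∣-trans c∣Fm (F-mono-∣ (divides x refl))))
  ... | Bézout.-+ x y eq = ∣m+n∣m⇒∣n c∣sum (∣n⇒∣m*n (B ^ d) (∣-trans c∣Fm (F-mono-∣ (divides x refl))))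
    where
    c∣sum : c ∣ B ^ d * F (x * m) + F d
    c∣sum = subst (c ∣_) (F-+ d (x * m)) (subst (λ z → c ∣ F z) (sym eq) (∣-trans c∣Fn (F-mono-∣ (divides y refl))))

  F>0 : ∀ {n} → 1 < B → 0 < n → 0 < F n
  F>0 {suc n} 1<B _ = ≤-trans (m<n⇒0<n∸m 1<B) (∸-monoˡ-≤ 1 (m≤m*n B (B ^ n) {{m^n≢0 B n}}))

  prime∤B⇒prime∤B^ : ∀ {p} n → Prime p → ¬ p ∣ B → ¬ p ∣ B ^ n
  prime∤B⇒prime∤B^ zero pr p∤B p∣1 = <⇒≱ (prime⇒≥2 pr) (∣⇒≤ p∣1)
  prime∤B⇒prime∤B^ (suc n) pr p∤B p∣B^n+1 =
    [ p∤B , prime∤B⇒prime∤B^ n pr p∤B ]′ (euclidsLemma B (B ^ n) pr p∣B^n+1)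

  -- Two of the p residues of b^0, …, b^(p-1) modulo p coincide, since none of them is 0.
  prime∤B⇒prime∣F : ∀ p → Prime p → ¬ p ∣ B → ∃[ k ] (0 < k × k < p × p ∣ F k)
  prime∤B⇒prime∣F p@(suc (suc p′)) pr p∤B with pigeonhole (≤-refl {p}) (λ i → fromℕ< (residue-1< (toℕ i)))
    where
    residue-1< : ∀ n → B ^ n % p ∸ 1 < suc p′
    residue-1< n = s≤s (∸-monoˡ-≤ 1 (s≤s⁻¹ (m%n<n (B ^ n) p)))
  ... | i , j , i<j , same = w ∸ u , m<n⇒0<n∸m i<j , ≤-<-trans (m∸n≤m w u) (toℕ<n j) , p∣F
    where
    u = toℕ i
    w = toℕ j
    residue>0 : ∀ n → 0 < B ^ n % p
    residue>0 n = n≢0⇒n>0 (λ r≡0 → prime∤B⇒prime∤B^ n pr p∤B (m%n≡0⇒n∣m (B ^ n) p r≡0))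
    residues≡ : B ^ w % p ≡ B ^ u % p
    residues≡ = sym (∸-cancelʳ-≡ (residue>0 u) (residue>0 w)
      (trans (sym (toℕ-fromℕ< _)) (trans (cong toℕ same) (toℕ-fromℕ< _))))
    p∣difference : p ∣ B ^ w ∸ B ^ u
    p∣difference = %-≡⇒∣∸ (B ^ w) (B ^ u) p residues≡
    difference≡ : B ^ w ∸ B ^ u ≡ B ^ u * F (w ∸ u)
    difference≡ = begin
      B ^ w ∸ B ^ u                        ≡⟨ cong₂ _∸_ (B^≡1+F w) (B^≡1+F u) ⟩
      F w ∸ F u                            ≡⟨ cong (λ z → F z ∸ F u) (sym (m+[n∸m]≡n (<⇒≤ i<j))) ⟩
      F (u + (w ∸ u)) ∸ F u                ≡⟨ cong (_∸ F u) (F-+ u (w ∸ u)) ⟩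
      B ^ u * F (w ∸ u) + F u ∸ F u        ≡⟨ m+n∸n≡m _ (F u) ⟩
      B ^ u * F (w ∸ u)                    ∎
      where open ≡-Reasoning
    p∣F : p ∣ F (w ∸ u)
    p∣F = [ (λ p∣B^u → ⊥-elim (prime∤B⇒prime∤B^ u pr p∤B p∣B^u)) , id ]′
            (euclidsLemma (B ^ u) (F (w ∸ u)) pr (subst (p ∣_) difference≡ p∣difference))

∑ : (ℕ → Bool) → (ℕ → ℕ) → ℕ → ℕ
∑ P f zero = 0
∑ P f (suc L) = ∑ P f L + (if P (suc L) then f (suc L) else 0)

∏ : (ℕ → Bool) → (ℕ → ℕ) → ℕ → ℕ
∏ P f zero = 1
∏ P f (suc L) = ∏ P f L * (if P (suc L) then f (suc L) else 1)

∑-cong : ∀ P Q f g L → (∀ d → 0 < d → d ≤ L → (if P d then f d else 0) ≡ (if Q d then g d else 0)) →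
         ∑ P f L ≡ ∑ Q g L
∑-cong P Q f g zero h = refl
∑-cong P Q f g (suc L) h =
  cong₂ _+_ (∑-cong P Q f g L (λ d 0<d d≤L → h d 0<d (m≤n⇒m≤1+n d≤L))) (h (suc L) (s≤s z≤n) ≤-refl)

∏-cong : ∀ P Q f g L → (∀ d → 0 < d → d ≤ L → (if P d then f d else 1) ≡ (if Q d then g d else 1)) →
         ∏ P f L ≡ ∏ Q g L
∏-cong P Q f g zero h = refl
∏-cong P Q f g (suc L) h =
  cong₂ _*_ (∏-cong P Q f g L (λ d 0<d d≤L → h d 0<d (m≤n⇒m≤1+n d≤L))) (h (suc L) (s≤s z≤n) ≤-refl)

∑-trim : ∀ P f x L → x ≤ L → (∀ d → x < d → d ≤ L → P d ≡ false) → ∑ P f L ≡ ∑ P f x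
∑-trim P f x zero z≤n h = refl
∑-trim P f x (suc L) x≤L h with m≤n⇒m<n∨m≡n x≤L
... | inj₂ refl = refl
... | inj₁ x<1+L rewrite h (suc L) x<1+L ≤-refl =
  trans (+-identityʳ _) (∑-trim P f x L (s≤s⁻¹ x<1+L) (λ d x<d d≤L → h d x<d (m≤n⇒m≤1+n d≤L)))

∏-trim : ∀ P f x L → x ≤ L → (∀ d → x < d → d ≤ L → P d ≡ false) → ∏ P f L ≡ ∏ P f x
∏-trim P f x zero z≤n h = refl
∏-trim P f x (suc L) x≤L h with m≤n⇒m<n∨m≡n x≤L
... | inj₂ refl = refl
... | inj₁ x<1+L rewrite h (suc L) x<1+L ≤-refl =
  trans (*-identityʳ _) (∏-trim P f x L (s≤s⁻¹ x<1+L) (λ d x<d d≤L → h d x<d (m≤n⇒m≤1+n d≤L)))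

∑-∨-∧ : ∀ (P Q : ℕ → Bool) f L →
        ∑ (λ d → P d ∨ Q d) f L + ∑ (λ d → P d ∧ Q d) f L ≡ ∑ P f L + ∑ Q f L
∑-∨-∧ P Q f zero = refl
∑-∨-∧ P Q f (suc L) = begin
    (∑∨ + pick (P n ∨ Q n)) + (∑∧ + pick (P n ∧ Q n)) ≡⟨ interchange ∑∨ (pick (P n ∨ Q n)) ∑∧ _ ⟩
    (∑∨ + ∑∧) + (pick (P n ∨ Q n) + pick (P n ∧ Q n)) ≡⟨ cong₂ _+_ (∑-∨-∧ P Q f L) (pointwise (P n) (Q n)) ⟩
    (∑ P f L + ∑ Q f L) + (pick (P n) + pick (Q n))   ≡⟨ sym (interchange (∑ P f L) (pick (P n)) (∑ Q f L) _) ⟩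
    (∑ P f L + pick (P n)) + (∑ Q f L + pick (Q n))   ∎
  where
  open ≡-Reasoning
  n = suc L
  ∑∨ = ∑ (λ d → P d ∨ Q d) f L
  ∑∧ = ∑ (λ d → P d ∧ Q d) f L
  pick : Bool → ℕ
  pick c = if c then f n else 0
  interchange : ∀ a x b y → (a + x) + (b + y) ≡ (a + b) + (x + y)
  interchange = solve-∀
  pointwise : ∀ p q → pick (p ∨ q) + pick (p ∧ q) ≡ pick p + pick q
  pointwise true true = refl
  pointwise true false = refl
  pointwise false true = +-identityʳ (f n)
  pointwise false false = refl

∏-split : ∀ (P Q : ℕ → Bool) f L → ∏ P f L ≡ ∏ (λ d → P d ∧ Q d) f L * ∏ (λ d → P d ∧ not (Q d)) f L
∏-split P Q f zero = refl
∏-split P Q f (suc L) = begin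
    ∏ P f L * pick (P n)                          ≡⟨ cong₂ _*_ (∏-split P Q f L) (pointwise (P n) (Q n)) ⟩
    (∏∧ * ∏∧¬) * (pick (P n ∧ Q n) * pick (P n ∧ not (Q n))) ≡⟨ interchange ∏∧ ∏∧¬ _ _ ⟩
    (∏∧ * pick (P n ∧ Q n)) * (∏∧¬ * pick (P n ∧ not (Q n))) ∎
  where
  open ≡-Reasoning
  n = suc L
  ∏∧ = ∏ (λ d → P d ∧ Q d) f L
  ∏∧¬ = ∏ (λ d → P d ∧ not (Q d)) f L
  pick : Bool → ℕ
  pick c = if c then f n else 1
  interchange : ∀ a b x y → (a * b) * (x * y) ≡ (a * x) * (b * y)
  interchange = solve-∀
  pointwise : ∀ p q → pick p ≡ pick (p ∧ q) * pick (p ∧ not q)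
  pointwise true true = sym (*-identityʳ (f n))
  pointwise true false = sym (+-identityʳ (f n))
  pointwise false q = refl

∏>0 : ∀ P f L → (∀ d → 0 < d → d ≤ L → P d ≡ true → 0 < f d) → 0 < ∏ P f L
∏>0 P f zero h = s≤s z≤n
∏>0 P f (suc L) h = *-mono-≤ (∏>0 P f L (λ d 0<d d≤L → h d 0<d (m≤n⇒m≤1+n d≤L))) last>0
  where
  last>0 : 0 < (if P (suc L) then f (suc L) else 1)
  last>0 with P (suc L) | h (suc L) (s≤s z≤n) ≤-refl
  ... | true | f>0 = f>0 refl
  ... | false | _ = s≤s z≤n

prodCyc≡∏ : ∀ f b N L → prodCyc f b (filter (_∣? N) (range1 L)) ≡ ∏ (_∣ᵇ N) (λ d → cycF f d b) L
prodCyc≡∏ f b N zero = refl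
prodCyc≡∏ f b N (suc L) = begin
    prodCyc f b (filter (_∣? N) (range1 (suc L)))
      ≡⟨ cong (λ ds → prodCyc f b (filter (_∣? N) ds)) range1-snoc ⟩
    prodCyc f b (filter (_∣? N) (range1 L ++ suc L ∷ []))
      ≡⟨ cong (prodCyc f b) (filter-++ (_∣? N) (range1 L) (suc L ∷ [])) ⟩
    prodCyc f b (filter (_∣? N) (range1 L) ++ filter (_∣? N) (suc L ∷ []))
      ≡⟨ prodCyc-++ (filter (_∣? N) (range1 L)) (filter (_∣? N) (suc L ∷ [])) ⟩
    prodCyc f b (filter (_∣? N) (range1 L)) * prodCyc f b (filter (_∣? N) (suc L ∷ []))
      ≡⟨ cong₂ _*_ (prodCyc≡∏ f b N L) last ⟩
    ∏ (_∣ᵇ N) (λ d → cycF f d b) (suc L) ∎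
  where
  open ≡-Reasoning
  range1-snoc : range1 (suc L) ≡ range1 L ++ suc L ∷ []
  range1-snoc = trans (cong (map suc) (sym (upTo-∷ʳ L))) (map-++ suc (upTo L) (L ∷ []))
  prodCyc-++ : ∀ xs ys → prodCyc f b (xs ++ ys) ≡ prodCyc f b xs * prodCyc f b ys
  prodCyc-++ [] ys = sym (+-identityʳ _)
  prodCyc-++ (x ∷ xs) ys rewrite prodCyc-++ xs ys = sym (*-assoc (cycF f x b) _ _)
  last : prodCyc f b (filter (_∣? N) (suc L ∷ [])) ≡ (if suc L ∣ᵇ N then cycF f (suc L) b else 1)
  last with does (suc L ∣? N)
  ... | true = *-identityʳ _
  ... | false = refl

IsValuation : ℕ → ℕ → ℕ → Set
IsValuation p n k = p ^ k ∣ n × ¬ p ^ suc k ∣ n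

-- The first argument is fuel: n divisions by p always suffice for n > 0.
valuation-fuel : ℕ → ℕ → ℕ → ℕ
valuation-fuel zero p n = 0
valuation-fuel (suc f) p n with p ∣? n
... | yes _ = suc (valuation-fuel f p (n /′ p))
... | no _ = 0

val : ℕ → ℕ → ℕ
val p n = valuation-fuel n p n

valuation-fuel-correct : ∀ f p n → 2 ≤ p → 0 < n → n ≤ f → IsValuation p n (valuation-fuel f p n)
valuation-fuel-correct zero p zero _ () _
valuation-fuel-correct zero p (suc n) _ _ ()
valuation-fuel-correct (suc f) zero n () _ _
valuation-fuel-correct (suc f) (suc zero) n (s≤s ()) _ _
valuation-fuel-correct (suc f) p@(suc (suc q)) n 2≤p 0<n n≤f with p ∣? n
... | no p∤n = divides n (sym (*-identityʳ n)) , λ p^1∣n → p∤n (subst (_∣ n) (*-identityʳ p) p^1∣n)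
... | yes (divides n′ refl) rewrite m*n/n≡m n′ p {{_}} = p^k+1∣n , p^k+2∤n
  where
  0<n′ : 0 < n′
  0<n′ = *>0⇒ˡ>0 n′ p 0<n
  n′<n : n′ < n′ * p
  n′<n = m<m*n n′ p {{>-nonZero 0<n′}} 2≤p
  ih : IsValuation p n′ (valuation-fuel f p n′)
  ih = valuation-fuel-correct f p n′ 2≤p 0<n′ (s≤s⁻¹ (≤-trans n′<n n≤f))
  k = valuation-fuel f p n′
  p^k+1∣n : p ^ suc k ∣ n′ * p
  p^k+1∣n = subst (_∣ n′ * p) (*-comm (p ^ k) p) (*-monoˡ-∣ p (proj₁ ih))
  p^k+2∤n : ¬ p ^ suc (suc k) ∣ n′ * p
  p^k+2∤n h = proj₂ ih (*-cancelʳ-∣ p (subst (_∣ n′ * p) (*-comm p (p ^ suc k)) h))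

val-correct : ∀ p n → 2 ≤ p → 0 < n → IsValuation p n (val p n)
val-correct p n 2≤p 0<n = valuation-fuel-correct n p n 2≤p 0<n ≤-refl

^-monoʳ-∣ : ∀ p {i j} → i ≤ j → p ^ i ∣ p ^ j
^-monoʳ-∣ p {i} {j} i≤j =
  divides (p ^ (j ∸ i)) (trans (cong (p ^_) (sym (m∸n+n≡m i≤j))) (^-distribˡ-+-* p (j ∸ i) i))

IsValuation-unique : ∀ {p n k k′} → IsValuation p n k → IsValuation p n k′ → k ≡ k′
IsValuation-unique {p} {n} {k} {k′} (p^k∣n , p^k+1∤n) (p^k′∣n , p^k′+1∤n) with <-cmp k k′
... | tri≈ _ k≡k′ _ = k≡k′
... | tri< k<k′ _ _ = ⊥-elim (p^k+1∤n (∣-trans (^-monoʳ-∣ p k<k′) p^k′∣n))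
... | tri> _ _ k>k′ = ⊥-elim (p^k′+1∤n (∣-trans (^-monoʳ-∣ p k>k′) p^k∣n))

val-unique : ∀ {p n k} → 2 ≤ p → 0 < n → IsValuation p n k → val p n ≡ k
val-unique {p} {n} 2≤p 0<n = IsValuation-unique (val-correct p n 2≤p 0<n)

p^val∣ : ∀ p n → 2 ≤ p → 0 < n → p ^ val p n ∣ n
p^val∣ p n 2≤p 0<n = proj₁ (val-correct p n 2≤p 0<n)

p^k∣⇒k≤val : ∀ p n k → 2 ≤ p → 0 < n → p ^ k ∣ n → k ≤ val p n
p^k∣⇒k≤val p n k 2≤p 0<n p^k∣n with k ≤? val p n
... | yes k≤v = k≤v
... | no k≰v = ⊥-elim (proj₂ (val-correct p n 2≤p 0<n) (∣-trans (^-monoʳ-∣ p (≰⇒> k≰v)) p^k∣n))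

val-1 : ∀ p → 2 ≤ p → val p 1 ≡ 0
val-1 p 2≤p = val-unique 2≤p (s≤s z≤n) (∣-refl , λ p∣1 → <⇒≱ (subst (1 <_) (sym (*-identityʳ p)) 2≤p) (∣⇒≤ p∣1))

val-* : ∀ p m n → Prime p → 0 < m → 0 < n → val p (m * n) ≡ val p m + val p n
val-* p m n pr 0<m 0<n = val-unique 2≤p (*-mono-≤ 0<m 0<n) (p^i+j∣mn , p^i+j+1∤mn)
  where
  2≤p : 2 ≤ p
  2≤p = prime⇒≥2 pr
  i = val p m
  j = val p n
  m-spec : IsValuation p m i
  m-spec = val-correct p m 2≤p 0<m
  n-spec : IsValuation p n j
  n-spec = val-correct p n 2≤p 0<n
  m′ = quotient (proj₁ m-spec)
  n′ = quotient (proj₁ n-spec)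
  m≡ : m ≡ m′ * p ^ i
  m≡ = m∣n⇒n≡quotient*m (proj₁ m-spec)
  n≡ : n ≡ n′ * p ^ j
  n≡ = m∣n⇒n≡quotient*m (proj₁ n-spec)
  p∤m′ : ¬ p ∣ m′
  p∤m′ (divides t eq) = proj₂ m-spec (divides t (trans m≡ (trans (cong (_* p ^ i) eq) (*-assoc t p (p ^ i)))))
  p∤n′ : ¬ p ∣ n′
  p∤n′ (divides t eq) = proj₂ n-spec (divides t (trans n≡ (trans (cong (_* p ^ j) eq) (*-assoc t p (p ^ j)))))
  interchange : ∀ a b c d → (a * c) * (b * d) ≡ (a * b) * (c * d)
  interchange = solve-∀
  mn≡ : m * n ≡ (m′ * n′) * p ^ (i + j)
  mn≡ = trans (cong₂ _*_ m≡ n≡)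
       (trans (interchange m′ n′ (p ^ i) (p ^ j)) (cong ((m′ * n′) *_) (sym (^-distribˡ-+-* p i j))))
  p^i+j∣mn : p ^ (i + j) ∣ m * n
  p^i+j∣mn = divides (m′ * n′) mn≡
  p^i+j+1∤mn : ¬ p ^ suc (i + j) ∣ m * n
  p^i+j+1∤mn h = [ p∤m′ , p∤n′ ]′ (euclidsLemma m′ n′ pr p∣m′n′)
    where
    instance _ = m^n≢0 p (i + j) {{>-nonZero (≤-trans (s≤s z≤n) 2≤p)}}
    p∣m′n′ : p ∣ m′ * n′
    p∣m′n′ = *-cancelʳ-∣ (p ^ (i + j)) (subst (p ^ suc (i + j) ∣_) mn≡ h)

val-mono-∣ : ∀ p m n → Prime p → 0 < n → m ∣ n → val p m ≤ val p n
val-mono-∣ p m n pr 0<n (divides q refl) =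
  subst (val p m ≤_) (sym (trans (cong (val p) (*-comm q m)) (val-* p m q pr 0<m 0<q))) (m≤m+n (val p m) (val p q))
  where
  0<m : 0 < m
  0<m = *>0⇒ʳ>0 q m 0<n
  0<q : 0 < q
  0<q = *>0⇒ˡ>0 q m 0<n

val-∏ : ∀ p P f L → Prime p → (∀ d → 0 < d → d ≤ L → P d ≡ true → 0 < f d) →
        val p (∏ P f L) ≡ ∑ P (λ d → val p (f d)) L
val-∏ p P f zero pr f>0 = val-1 p (prime⇒≥2 pr)
val-∏ p P f (suc L) pr f>0 = begin
    val p (∏ P f L * last)             ≡⟨ val-* p (∏ P f L) last pr (∏>0 P f L f>0′) last>0 ⟩
    val p (∏ P f L) + val p last       ≡⟨ cong₂ _+_ (val-∏ p P f L pr f>0′) val-last ⟩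
    ∑ P (λ d → val p (f d)) (suc L)    ∎
  where
  open ≡-Reasoning
  f>0′ : ∀ d → 0 < d → d ≤ L → P d ≡ true → 0 < f d
  f>0′ d 0<d d≤L = f>0 d 0<d (m≤n⇒m≤1+n d≤L)
  last = if P (suc L) then f (suc L) else 1
  last>0 : 0 < last
  last>0 with P (suc L) | f>0 (suc L) (s≤s z≤n) ≤-refl
  ... | true | h = h refl
  ... | false | _ = s≤s z≤n
  val-last : val p last ≡ (if P (suc L) then val p (f (suc L)) else 0)
  val-last with P (suc L)
  ... | true = refl
  ... | false = val-1 p (prime⇒≥2 pr)

∣-by-valuations : ∀ a b → 0 < a → 0 < b → (∀ p → Prime p → val p a ≤ val p b) → a ∣ b
∣-by-valuations a = go a (<-wellFounded a)
  where
  go : ∀ a → Acc _<_ a → ∀ b → 0 < a → 0 < b → (∀ p → Prime p → val p a ≤ val p b) → a ∣ b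
  go 1 _ b _ _ _ = 1∣ b
  go a@(suc (suc _)) (acc rec) b 0<a 0<b a≤b with prime-divisor a (s≤s (s≤s z≤n))
  ... | p , pr , divides a′ a≡ = subst₂ _∣_ (sym a≡) (sym b≡) (*-monoˡ-∣ p a′∣b′)
    where
    2≤p : 2 ≤ p
    2≤p = prime⇒≥2 pr
    0<p : 0 < p
    0<p = ≤-trans (s≤s z≤n) 2≤p
    p∣b : p ∣ b
    1≤val-a : 1 ≤ val p a
    1≤val-a = p^k∣⇒k≤val p a 1 2≤p 0<a (subst (_∣ a) (sym (*-identityʳ p)) (divides a′ a≡))
    p∣b = subst (_∣ b) (*-identityʳ p)
            (∣-trans (^-monoʳ-∣ p (≤-trans 1≤val-a (a≤b p pr))) (p^val∣ p b 2≤p 0<b))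
    b′ = quotient p∣b
    b≡ : b ≡ b′ * p
    b≡ = m∣n⇒n≡quotient*m p∣b
    0<a′ : 0 < a′
    0<a′ = *>0⇒ˡ>0 a′ p (subst (0 <_) a≡ 0<a)
    0<b′ : 0 < b′
    0<b′ = *>0⇒ˡ>0 b′ p (subst (0 <_) b≡ 0<b)
    a′<a : a′ < a
    a′<a = subst (a′ <_) (sym a≡) (m<m*n a′ p {{>-nonZero 0<a′}} 2≤p)
    a′≤b′ : ∀ q → Prime q → val q a′ ≤ val q b′
    a′≤b′ q qr = +-cancelʳ-≤ (val q p) (val q a′) (val q b′)
      (subst₂ _≤_ (trans (cong (val q) a≡) (val-* q a′ p qr 0<a′ 0<p))
                  (trans (cong (val q) b≡) (val-* q b′ p qr 0<b′ 0<p)) (a≤b q qr))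
    a′∣b′ : a′ ∣ b′
    a′∣b′ = go a′ (rec a′<a) b′ 0<a′ 0<b′ a′≤b′

∣ᵇ-gcd : ∀ d x y → (d ∣ᵇ x ∧ d ∣ᵇ y) ≡ d ∣ᵇ gcd x y
∣ᵇ-gcd d x y with d ∣? x | d ∣? y | d ∣? gcd x y
... | yes _   | yes _   | yes _   = refl
... | yes d∣x | yes d∣y | no d∤g  = ⊥-elim (d∤g (gcd-greatest d∣x d∣y))
... | yes _   | no d∤y  | yes d∣g = ⊥-elim (d∤y (∣-trans d∣g (gcd[m,n]∣n x y)))
... | yes _   | no _    | no _    = refl
... | no d∤x  | _       | yes d∣g = ⊥-elim (d∤x (∣-trans d∣g (gcd[m,n]∣m x y)))
... | no _    | _       | no _    = refl

any-∣ᵇ-gcd : ∀ d x ys → (d ∣ᵇ x ∧ any (d ∣ᵇ_) ys) ≡ any (d ∣ᵇ_) (map (gcd x) ys)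
any-∣ᵇ-gcd d x [] = ∧-zeroʳ (d ∣ᵇ x)
any-∣ᵇ-gcd d x (y ∷ ys) =
  trans (∧-distribˡ-∨ (d ∣ᵇ x) (d ∣ᵇ y) (any (d ∣ᵇ_) ys)) (cong₂ _∨_ (∣ᵇ-gcd d x y) (any-∣ᵇ-gcd d x ys))

maximum : List ℕ → ℕ
maximum = foldr _⊔_ 0

m⊓n+m⊔n : ∀ m n → m ⊓ n + (m ⊔ n) ≡ m + n
m⊓n+m⊔n m n with ≤-total m n
... | inj₁ m≤n = cong₂ _+_ (m≤n⇒m⊓n≡m m≤n) (m≤n⇒m⊔n≡n m≤n)
... | inj₂ n≤m = trans (cong₂ _+_ (m≥n⇒m⊓n≡n n≤m) (m≥n⇒m⊔n≡m n≤m)) (+-comm n m)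

maximum-⊓ : ∀ c (g : ℕ → ℕ) ys → maximum (map (λ y → c ⊓ g y) ys) ≡ c ⊓ maximum (map g ys)
maximum-⊓ c g [] = sym (⊓-zeroʳ c)
maximum-⊓ c g (y ∷ ys) =
  trans (cong (c ⊓ g y ⊔_) (maximum-⊓ c g ys)) (sym (⊓-distribˡ-⊔ c (g y) (maximum (map g ys))))

maximum-≤ : ∀ xs K → All (_≤ K) xs → maximum xs ≤ K
maximum-≤ [] K [] = z≤n
maximum-≤ (x ∷ xs) K (x≤K ∷ xs≤K) = ⊔-lub x≤K (maximum-≤ xs K xs≤K)

module DivisorUnion (φ V : ℕ → ℕ) (L : ℕ)
  (∑-divisors : ∀ x → 0 < x → x ≤ L → ∑ (_∣ᵇ x) φ L ≡ V x)
  (V-gcd : ∀ x y → 0 < x → 0 < y → V (gcd x y) ≡ V x ⊓ V y) where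

  InRange : ℕ → Set
  InRange x = 0 < x × x ≤ L

  gcd-InRange : ∀ {x zs} → InRange x → All InRange zs → All InRange (map (gcd x) zs)
  gcd-InRange _ [] = []
  gcd-InRange {x} {z ∷ _} x-in@(0<x , x≤L) (_ ∷ zs-in) =
    (gcd>0 x z 0<x , ≤-trans (∣⇒≤ {{>-nonZero 0<x}} (gcd[m,n]∣m x z)) x≤L) ∷ gcd-InRange x-in zs-in

  V-gcd-map : ∀ x {zs} → 0 < x → All InRange zs → map V (map (gcd x) zs) ≡ map (λ y → V x ⊓ V y) zs
  V-gcd-map x 0<x [] = refl
  V-gcd-map x 0<x ((0<z , _) ∷ zs-in) = cong₂ _∷_ (V-gcd x _ 0<x 0<z) (V-gcd-map x 0<x zs-in)

  ∑-⋃-divisors : ∀ xs → All InRange xs → ∑ (λ d → any (d ∣ᵇ_) xs) φ L ≡ maximum (map V xs)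
  ∑-⋃-divisors xs = go (length xs) xs ≤-refl
    where
    go : ∀ n xs → length xs ≤ n → All InRange xs → ∑ (λ d → any (d ∣ᵇ_) xs) φ L ≡ maximum (map V xs)
    go n [] _ [] = ∑-false L
      where
      ∑-false : ∀ L → ∑ (λ _ → false) φ L ≡ 0
      ∑-false zero = refl
      ∑-false (suc L) = trans (+-identityʳ _) (∑-false L)
    -- Inclusion–exclusion: the divisors of x that divide some y are those dividing some gcd x y.
    go (suc n) (x ∷ ys) (s≤s |ys|≤n) ((0<x , x≤L) ∷ ys-in) = +-cancelʳ-≡ (V x ⊓ M) _ _ (begin
        ∑∪ + V x ⊓ M                                  ≡⟨ cong (∑∪ +_) (sym intersection) ⟩
        ∑∪ + ∑ (λ d → d ∣ᵇ x ∧ any (d ∣ᵇ_) ys) φ L     ≡⟨ ∑-∨-∧ (_∣ᵇ x) (λ d → any (d ∣ᵇ_) ys) φ L ⟩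
        ∑ (_∣ᵇ x) φ L + ∑ (λ d → any (d ∣ᵇ_) ys) φ L   ≡⟨ cong₂ _+_ (∑-divisors x 0<x x≤L) (go n ys |ys|≤n ys-in) ⟩
        V x + M                                       ≡⟨ sym (m⊓n+m⊔n (V x) M) ⟩
        V x ⊓ M + (V x ⊔ M)                           ≡⟨ +-comm (V x ⊓ M) _ ⟩
        (V x ⊔ M) + V x ⊓ M                           ∎)
      where
      open ≡-Reasoning
      ∑∪ = ∑ (λ d → any (d ∣ᵇ_) (x ∷ ys)) φ L
      M = maximum (map V ys)
      gs = map (gcd x) ys
      |gs|≤n : length gs ≤ n
      |gs|≤n = subst (_≤ n) (sym (length-map (gcd x) ys)) |ys|≤n
      intersection : ∑ (λ d → d ∣ᵇ x ∧ any (d ∣ᵇ_) ys) φ L ≡ V x ⊓ M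
      intersection = begin
        ∑ (λ d → d ∣ᵇ x ∧ any (d ∣ᵇ_) ys) φ L
          ≡⟨ ∑-cong _ (λ d → any (d ∣ᵇ_) gs) φ φ L (λ d _ _ → cong (λ c → if c then φ d else 0) (any-∣ᵇ-gcd d x ys)) ⟩
        ∑ (λ d → any (d ∣ᵇ_) gs) φ L         ≡⟨ go n gs |gs|≤n (gcd-InRange (0<x , x≤L) ys-in) ⟩
        maximum (map V gs)                   ≡⟨ cong maximum (V-gcd-map x 0<x ys-in) ⟩
        maximum (map (λ y → V x ⊓ V y) ys)   ≡⟨ maximum-⊓ (V x) V ys ⟩
        V x ⊓ M                              ∎

divisorsUpTo : ℕ → ℕ → List ℕ
divisorsUpTo N zero = []
divisorsUpTo N (suc l) with suc l ∣? N
... | yes _ = suc l ∷ divisorsUpTo N l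
... | no _ = divisorsUpTo N l

divisorsUpTo-∣ : ∀ N l → All (_∣ N) (divisorsUpTo N l)
divisorsUpTo-∣ N zero = []
divisorsUpTo-∣ N (suc l) with suc l ∣? N
... | yes l+1∣N = l+1∣N ∷ divisorsUpTo-∣ N l
... | no _ = divisorsUpTo-∣ N l

divisorsUpTo-bounded : ∀ N l L → l ≤ L → All (λ x → 0 < x × x ≤ L) (divisorsUpTo N l)
divisorsUpTo-bounded N zero L _ = []
divisorsUpTo-bounded N (suc l) L l+1≤L with suc l ∣? N
... | yes _ = (s≤s z≤n , l+1≤L) ∷ divisorsUpTo-bounded N l L (<⇒≤ l+1≤L)
... | no _ = divisorsUpTo-bounded N l L (<⇒≤ l+1≤L)

any-divisorsUpTo : ∀ N l d → 0 < d → d ≤ l → d ∣ N → any (d ∣ᵇ_) (divisorsUpTo N l) ≡ true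
any-divisorsUpTo N zero (suc d) _ () _
any-divisorsUpTo N (suc l) d 0<d d≤l+1 d∣N with m≤n⇒m<n∨m≡n d≤l+1 | suc l ∣? N
... | inj₂ refl | yes _ rewrite dec-true (suc l ∣? suc l) ∣-refl = refl
... | inj₂ refl | no l+1∤N = ⊥-elim (l+1∤N d∣N)
... | inj₁ d<l+1 | yes _ =
  trans (cong (d ∣ᵇ suc l ∨_) (any-divisorsUpTo N l d 0<d (s≤s⁻¹ d<l+1) d∣N)) (∨-zeroʳ (d ∣ᵇ suc l))
... | inj₁ d<l+1 | no _ = any-divisorsUpTo N l d 0<d (s≤s⁻¹ d<l+1) d∣N

any-∣ᵇ-false : ∀ {N} xs d → All (_∣ N) xs → ¬ d ∣ N → any (d ∣ᵇ_) xs ≡ false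
any-∣ᵇ-false [] d [] d∤N = refl
any-∣ᵇ-false (x ∷ xs) d (x∣N ∷ xs∣N) d∤N rewrite dec-false (d ∣? x) (λ d∣x → d∤N (∣-trans d∣x x∣N)) =
  any-∣ᵇ-false xs d xs∣N d∤N

module Cyclotomic (B : ℕ) (1<B : 1 < B) where

  instance
    B≢0 : NonZero B
    B≢0 = >-nonZero (<-trans (s≤s z≤n) 1<B)

  open PowerMinusOne B public

  ∏Φ : ℕ → ℕ → ℕ
  ∏Φ N L = ∏ (_∣ᵇ N) (λ d → Φ d B) L

  cycF-fuel : ∀ f g d → 0 < d → d ≤ f → d ≤ g → cycF f d B ≡ cycF g d B
  cycF-fuel (suc f) (suc g) (suc d) _ d<f d<g = cong (F (suc d) /′_) (begin
      prodCyc f B (filter (_∣? suc d) (range1 d)) ≡⟨ prodCyc≡∏ f B (suc d) d ⟩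
      ∏ (_∣ᵇ suc d) (λ e → cycF f e B) d        ≡⟨ ∏-cong _ _ _ _ d same ⟩
      ∏ (_∣ᵇ suc d) (λ e → cycF g e B) d        ≡⟨ sym (prodCyc≡∏ g B (suc d) d) ⟩
      prodCyc g B (filter (_∣? suc d) (range1 d)) ∎)
    where
    open ≡-Reasoning
    same : ∀ e → 0 < e → e ≤ d →
           (if e ∣ᵇ suc d then cycF f e B else 1) ≡ (if e ∣ᵇ suc d then cycF g e B else 1)
    same e 0<e e≤d = cong (λ c → if e ∣ᵇ suc d then c else 1)
      (cycF-fuel f g e 0<e (≤-trans e≤d (s≤s⁻¹ d<f)) (≤-trans e≤d (s≤s⁻¹ d<g)))

  Φ-unfold : ∀ n → Φ (suc n) B ≡ F (suc n) /′ ∏Φ (suc n) n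
  Φ-unfold n = cong (F (suc n) /′_) (trans (prodCyc≡∏ n B (suc n) n) (∏-cong _ _ _ _ n same))
    where
    same : ∀ e → 0 < e → e ≤ n → (if e ∣ᵇ suc n then cycF n e B else 1) ≡ (if e ∣ᵇ suc n then Φ e B else 1)
    same e 0<e e≤n = cong (λ c → if e ∣ᵇ suc n then c else 1) (cycF-fuel n e e 0<e e≤n ≤-refl)

  ∏Φ-last : ∀ n → ∏Φ (suc n) (suc n) ≡ ∏Φ (suc n) n * Φ (suc n) B
  ∏Φ-last n rewrite dec-true (suc n ∣? suc n) ∣-refl = refl

  ∏Φ≡F⇒Φ>0 : ∀ n → ∏Φ (suc n) (suc n) ≡ F (suc n) → 0 < Φ (suc n) B
  ∏Φ≡F⇒Φ>0 n ∏Φ≡F = *>0⇒ʳ>0 (∏Φ (suc n) n) _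
    (subst (0 <_) (trans (sym ∏Φ≡F) (∏Φ-last n)) (F>0 {suc n} 1<B (s≤s z≤n)))

  Φ>0-below : ∀ n → (∀ x → 0 < x → x ≤ n → ∏Φ x x ≡ F x) → ∀ d → 0 < d → d ≤ n → 0 < Φ d B
  Φ>0-below n ∏Φ≡F-below (suc d) 0<d d≤n = ∏Φ≡F⇒Φ>0 d (∏Φ≡F-below (suc d) 0<d d≤n)

  module ProperDivisorValuation (p : ℕ) (pr : Prime p) (n : ℕ)
    (∏Φ≡F-below : ∀ x → 0 < x → x ≤ n → ∏Φ x x ≡ F x) where

    φ : ℕ → ℕ
    φ d = val p (Φ d B)

    V : ℕ → ℕ
    V x = val p (F x)

    ∑φ-divisors : ∀ x → 0 < x → x ≤ n → ∑ (_∣ᵇ x) φ n ≡ V x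
    ∑φ-divisors x 0<x x≤n = begin
      ∑ (_∣ᵇ x) φ n        ≡⟨ ∑-trim (_∣ᵇ x) φ x n x≤n (λ d x<d _ → ∣ᵇ-beyond d 0<x x<d) ⟩
      ∑ (_∣ᵇ x) φ x        ≡⟨ sym (val-∏ p (_∣ᵇ x) (λ d → Φ d B) x pr Φ>0) ⟩
      val p (∏Φ x x)       ≡⟨ cong (val p) (∏Φ≡F-below x 0<x x≤n) ⟩
      V x                  ∎
      where
      open ≡-Reasoning
      Φ>0 : ∀ d → 0 < d → d ≤ x → d ∣ᵇ x ≡ true → 0 < Φ d B
      Φ>0 d 0<d d≤x _ = Φ>0-below n ∏Φ≡F-below d 0<d (≤-trans d≤x x≤n)

    V-gcd : ∀ x y → 0 < x → 0 < y → V (gcd x y) ≡ V x ⊓ V y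
    V-gcd x y 0<x 0<y = ≤-antisym
      (⊓-glb (val-mono-∣ p _ _ pr (F>0 1<B 0<x) (F-mono-∣ (gcd[m,n]∣m x y)))
             (val-mono-∣ p _ _ pr (F>0 1<B 0<y) (F-mono-∣ (gcd[m,n]∣n x y))))
      (p^k∣⇒k≤val p (F (gcd x y)) (V x ⊓ V y) 2≤p (F>0 1<B (gcd>0 x y 0<x)) p^min∣)
      where
      2≤p : 2 ≤ p
      2≤p = prime⇒≥2 pr
      p^min∣ : p ^ (V x ⊓ V y) ∣ F (gcd x y)
      p^min∣ = ∣F-gcd x y (∣-trans (^-monoʳ-∣ p (m⊓n≤m (V x) (V y))) (p^val∣ p (F x) 2≤p (F>0 1<B 0<x)))
                          (∣-trans (^-monoʳ-∣ p (m⊓n≤n (V x) (V y))) (p^val∣ p (F y) 2≤p (F>0 1<B 0<y)))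

    open DivisorUnion φ V n ∑φ-divisors V-gcd

    ∑φ-proper-divisors≤V : ∑ (_∣ᵇ suc n) φ n ≤ V (suc n)
    ∑φ-proper-divisors≤V = begin
      ∑ (_∣ᵇ suc n) φ n                    ≡⟨ ∑-cong _ _ φ φ n same ⟩
      ∑ (λ d → any (d ∣ᵇ_) divisors) φ n   ≡⟨ ∑-⋃-divisors divisors (divisorsUpTo-bounded (suc n) n n ≤-refl) ⟩
      maximum (map V divisors)             ≤⟨ maximum-≤ (map V divisors) (V (suc n)) (V≤ divisors (divisorsUpTo-∣ (suc n) n)) ⟩
      V (suc n)                            ∎
      where
      open ≤-Reasoning
      divisors = divisorsUpTo (suc n) n
      same : ∀ d → 0 < d → d ≤ n → (if d ∣ᵇ suc n then φ d else 0) ≡ (if any (d ∣ᵇ_) divisors then φ d else 0)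
      same d 0<d d≤n with d ∣? suc n
      ... | yes d∣N rewrite any-divisorsUpTo (suc n) n d 0<d d≤n d∣N = refl
      ... | no d∤N rewrite any-∣ᵇ-false divisors d (divisorsUpTo-∣ (suc n) n) d∤N = refl
      V≤ : ∀ xs → All (_∣ suc n) xs → All (_≤ V (suc n)) (map V xs)
      V≤ [] [] = []
      V≤ (x ∷ xs) (x∣N ∷ xs∣N) = val-mono-∣ p (F x) (F (suc n)) pr (F>0 {suc n} 1<B (s≤s z≤n)) (F-mono-∣ x∣N) ∷ V≤ xs xs∣N

  ∏Φ≡F : ∀ N → 0 < N → ∏Φ N N ≡ F N
  ∏Φ≡F x = go x (<-wellFounded x)
    where
    go : ∀ N → Acc _<_ N → 0 < N → ∏Φ N N ≡ F N
    go (suc n) (acc rec) _ = begin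
        ∏Φ N N                 ≡⟨ ∏Φ-last n ⟩
        proper * Φ N B         ≡⟨ cong (proper *_) (Φ-unfold n) ⟩
        proper * (F N /′ proper) ≡⟨ m*[n/′m]≡n proper (F N) proper>0 proper∣F ⟩
        F N                    ∎
      where
      open ≡-Reasoning
      N = suc n
      proper = ∏Φ N n
      below : ∀ x → 0 < x → x ≤ n → ∏Φ x x ≡ F x
      below x 0<x x≤n = go x (rec (s≤s x≤n)) 0<x
      Φ>0 : ∀ d → 0 < d → d ≤ n → d ∣ᵇ N ≡ true → 0 < Φ d B
      Φ>0 d 0<d d≤n _ = Φ>0-below n below d 0<d d≤n
      proper>0 : 0 < proper
      proper>0 = ∏>0 (_∣ᵇ N) (λ d → Φ d B) n Φ>0
      proper∣F : proper ∣ F N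
      proper∣F = ∣-by-valuations proper (F N) proper>0 (F>0 {N} 1<B (s≤s z≤n)) λ p pr →
        subst (_≤ val p (F N)) (sym (val-∏ p (_∣ᵇ N) (λ d → Φ d B) n pr Φ>0))
          (ProperDivisorValuation.∑φ-proper-divisors≤V p pr n below)

  Φ∣F : ∀ N → 0 < N → Φ N B ∣ F N
  Φ∣F (suc n) 0<N = divides (∏Φ (suc n) n) (trans (sym (∏Φ≡F (suc n) 0<N)) (∏Φ-last n))

module PrimeDivisorsOfΦ (B : ℕ) (1<B : 1 < B) where

  open Cyclotomic B 1<B public

  Φ∣repunit : ∀ n′ q → 0 < n′ → 2 ≤ q → Φ (n′ * q) B ∣ repunit (B ^ n′) q
  Φ∣repunit n′ q 0<n′ 2≤q = go (n′ * q) refl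
    where
    n′<n′q : n′ < n′ * q
    n′<n′q = m<m*n n′ q {{>-nonZero 0<n′}} 2≤q
    go : ∀ N → N ≡ n′ * q → Φ N B ∣ repunit (B ^ n′) q
    go zero eq = ⊥-elim (<-irrefl eq (≤-<-trans z≤n n′<n′q))
    go (suc n) eq = divides rest (*-cancelˡ-≡ _ _ (F n′) {{>-nonZero (F>0 1<B 0<n′)}} F*repunit≡)
      where
      open ≡-Reasoning
      N = suc n
      n′≤n : n′ ≤ n
      n′≤n = s≤s⁻¹ (subst (n′ <_) (sym eq) n′<n′q)
      n′∣N : n′ ∣ N
      n′∣N = divides q (trans eq (*-comm n′ q))
      rest = ∏ (λ d → d ∣ᵇ N ∧ not (d ∣ᵇ n′)) (λ d → Φ d B) n
      ∏-divisors-of-n′ : ∏ (λ d → d ∣ᵇ N ∧ d ∣ᵇ n′) (λ d → Φ d B) n ≡ F n′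
      ∏-divisors-of-n′ = begin
          ∏ (λ d → d ∣ᵇ N ∧ d ∣ᵇ n′) (λ d → Φ d B) n ≡⟨ ∏-cong _ (_∣ᵇ n′) _ _ n same ⟩
          ∏Φ n′ n                                    ≡⟨ ∏-trim (_∣ᵇ n′) _ n′ n n′≤n (λ d n′<d _ → ∣ᵇ-beyond d 0<n′ n′<d) ⟩
          ∏Φ n′ n′                                   ≡⟨ ∏Φ≡F n′ 0<n′ ⟩
          F n′                                       ∎
        where
        same : ∀ d → 0 < d → d ≤ n →
               (if d ∣ᵇ N ∧ d ∣ᵇ n′ then Φ d B else 1) ≡ (if d ∣ᵇ n′ then Φ d B else 1)
        same d _ _ with d ∣? n′
        ... | yes d∣n′ rewrite dec-true (d ∣? N) (∣-trans d∣n′ n′∣N) = refl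
        ... | no _ rewrite ∧-zeroʳ (d ∣ᵇ N) = refl
      F*repunit≡ : F n′ * repunit (B ^ n′) q ≡ F n′ * (rest * Φ N B)
      F*repunit≡ = begin
        F n′ * repunit (B ^ n′) q      ≡⟨ sym (F-* n′ q) ⟩
        F (n′ * q)                     ≡⟨ cong F (sym eq) ⟩
        F N                            ≡⟨ sym (∏Φ≡F N (s≤s z≤n)) ⟩
        ∏Φ N N                         ≡⟨ ∏Φ-last n ⟩
        ∏Φ N n * Φ N B                 ≡⟨ cong (_* Φ N B) (∏-split (_∣ᵇ N) (_∣ᵇ n′) _ n) ⟩
        (∏ (λ d → d ∣ᵇ N ∧ d ∣ᵇ n′) (λ d → Φ d B) n * rest) * Φ N B
                                       ≡⟨ cong (λ z → (z * rest) * Φ N B) ∏-divisors-of-n′ ⟩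
        (F n′ * rest) * Φ N B          ≡⟨ *-assoc (F n′) rest (Φ N B) ⟩
        F n′ * (rest * Φ N B)          ∎

  p∣F⇒B^≡1+p* : ∀ {p n} → p ∣ F n → ∃[ t ] B ^ n ≡ 1 + p * t
  p∣F⇒B^≡1+p* {p} {n} (divides t Fn≡) = t , trans (B^≡1+F n) (cong suc (trans Fn≡ (*-comm t p)))

  -- Φ_N(b) divides 1 + c + … + c^(q-1) with c = b^n′ ≡ 1 (mod p), which is ≡ q (mod p).
  p∣Φ⇒p∣q : ∀ N p q n′ → p ∣ Φ N B → n′ * q ≡ N → 0 < n′ → 2 ≤ q → p ∣ F n′ → p ∣ q
  p∣Φ⇒p∣q N p q n′ p∣Φ eq 0<n′ 2≤q p∣F with p∣F⇒B^≡1+p* {p} {n′} p∣F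
  ... | t , B^n′≡ with repunit-mod p t q
  ... | T , repunit≡ = ∣m+n∣m⇒∣n (subst (p ∣_) (+-comm q (p * T)) p∣q+pT) (∣m⇒∣m*n T ∣-refl)
    where
    p∣q+pT : p ∣ q + p * T
    p∣q+pT = subst (p ∣_) (trans (cong (λ c → repunit c q) B^n′≡) repunit≡)
               (∣-trans p∣Φ (subst (λ M → Φ M B ∣ repunit (B ^ n′) q) eq (Φ∣repunit n′ q 0<n′ 2≤q)))

  p∣Φ⇒p∣N : ∀ N p k → Prime p → p ∣ Φ N B → 0 < k → k < N → p ∣ F k → ∃[ n′ ] (n′ * p ≡ N × p ∣ F n′)
  p∣Φ⇒p∣N N p k pr p∣Φ 0<k k<N p∣Fk = split-at (prime-divisor (quotient e∣N) (quotient>1 e∣N e<N))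
    where
    0<N : 0 < N
    0<N = <-≤-trans 0<k (<⇒≤ k<N)
    e : ℕ
    e = gcd k N
    e∣N : e ∣ N
    e∣N = gcd[m,n]∣n k N
    e<N : e < N
    e<N = ≤-<-trans (∣⇒≤ {{>-nonZero 0<k}} (gcd[m,n]∣m k N)) k<N
    p∣Fe : p ∣ F e
    p∣Fe = ∣F-gcd k N p∣Fk (∣-trans p∣Φ (Φ∣F N 0<N))
    split-at : ∃[ q ] (Prime q × q ∣ quotient e∣N) → ∃[ n′ ] (n′ * p ≡ N × p ∣ F n′)
    split-at (q , qr , divides m′ m≡m′q) = e * m′ , subst (λ r → e * m′ * r ≡ N) (sym p≡q) n′*q≡N , p∣Fn′
      where
      n′*q≡N : e * m′ * q ≡ N
      n′*q≡N = begin
        e * m′ * q         ≡⟨ *-assoc e m′ q ⟩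
        e * (m′ * q)       ≡⟨ cong (e *_) (sym m≡m′q) ⟩
        e * quotient e∣N   ≡⟨ sym (m∣n⇒n≡m*quotient e∣N) ⟩
        N                  ∎
        where open ≡-Reasoning
      p∣Fn′ : p ∣ F (e * m′)
      p∣Fn′ = ∣-trans p∣Fe (F-mono-∣ {e} {e * m′} (m∣m*n m′))
      p≡q : p ≡ q
      p≡q = primes-equal pr qr (p∣Φ⇒p∣q N p q (e * m′) p∣Φ n′*q≡N
              (*>0⇒ˡ>0 (e * m′) q (subst (0 <_) (sym n′*q≡N) 0<N)) (prime⇒≥2 qr) p∣Fn′)

  2∣F⇒B-odd : ∀ n → 0 < n → 2 ∣ F n → ∃[ u ] B ≡ suc (u * 2)
  2∣F⇒B-odd n 0<n (divides t Fn≡) with even⊎odd B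
  ... | inj₂ B-odd = B-odd
  ... | inj₁ (w , B≡) with n
  ...   | suc n = ⊥-elim (odd≢even t (w * B ^ n) (begin
      suc (t * 2)        ≡⟨ cong suc (sym Fn≡) ⟩
      suc (F (suc n))    ≡⟨ sym (B^≡1+F (suc n)) ⟩
      B * B ^ n          ≡⟨ cong (_* B ^ n) B≡ ⟩
      w * 2 * B ^ n      ≡⟨ lemma w (B ^ n) ⟩
      w * B ^ n * 2      ∎))
    where
    open ≡-Reasoning
    lemma : ∀ w x → w * 2 * x ≡ w * x * 2
    lemma = solve-∀

  B-odd⇒2∣F : (∃[ u ] B ≡ suc (u * 2)) → ∀ r → 2 ∣ F r
  B-odd⇒2∣F (u , B≡) r = ∣-trans (divides u F1≡) (F-mono-∣ (1∣ r))
    where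
    F1≡ : F 1 ≡ u * 2
    F1≡ = cong (_∸ 1) (trans (*-identityʳ B) B≡)

  odd-p²∤Φ : ∀ N h n′ → 0 < h → let p = suc (h * 2) in 0 < n′ → n′ * p ≡ N → p ∣ F n′ → ¬ p * p ∣ Φ N B
  odd-p²∤Φ N h n′ 0<h 0<n′ n′p≡N p∣Fn′ p²∣Φ with p∣F⇒B^≡1+p* {suc (h * 2)} {n′} p∣Fn′
  ... | t , B^n′≡ = p²∤repunit-odd h t 0<h (∣-trans p²∣Φ
    (subst₂ (λ M c → Φ M B ∣ repunit c p) n′p≡N B^n′≡ (Φ∣repunit n′ p 0<n′ (s≤s (≤-trans 0<h (m≤m*n h 2))))))
    where
    p = suc (h * 2)

  -- Here b is odd. If n′ is even, Φ_N(b) divides 1 + c² ≡ 2 (mod 4) with c = b^(n′/2) odd;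
  -- if n′ is odd, an odd prime factor q of n′ would satisfy 2 ∣ q.
  4∤Φ : ∀ N n′ → 3 ≤ N → 2 ∣ Φ N B → n′ * 2 ≡ N → 2 ∣ F n′ → ¬ 4 ∣ Φ N B
  4∤Φ N n′ 3≤N 2∣Φ n′2≡N 2∣Fn′ = by-parity (even⊎odd n′)
    where
    0<N : 0 < N
    0<N = <-trans (s≤s z≤n) 3≤N
    0<n′ : 0 < n′
    0<n′ = *>0⇒ˡ>0 n′ 2 (subst (0 <_) (sym n′2≡N) 0<N)
    B-odd : ∃[ u ] B ≡ suc (u * 2)
    B-odd = 2∣F⇒B-odd n′ 0<n′ 2∣Fn′
    by-parity : (∃[ r ] n′ ≡ r * 2) ⊎ (∃[ h ] n′ ≡ suc (h * 2)) → ¬ 4 ∣ Φ N B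
    by-parity (inj₁ (r , refl)) 4∣Φ with B-odd⇒2∣F B-odd r
    ... | divides t Fr≡ = 4∤2+4* (t * t + t) (∣-trans 4∣Φ Φ∣2+4*)
      where
      B^r*2≡ : B ^ (r * 2) ≡ suc (t * 2) ^ 2
      B^r*2≡ = trans (sym (^-*-assoc B r 2)) (cong (_^ 2) (trans (B^≡1+F r) (cong suc Fr≡)))
      Φ∣2+4* : Φ N B ∣ 2 + 4 * (t * t + t)
      Φ∣2+4* = subst₂ (λ M c → Φ M B ∣ c) n′2≡N (trans (cong (λ c → repunit c 2) B^r*2≡) (repunit[odd²,2] t))
                 (Φ∣repunit (r * 2) 2 0<n′ ≤-refl)
    by-parity (inj₂ (h , refl)) _ with prime-divisor n′ (2≤n′ n′ (subst (3 ≤_) (sym n′2≡N) 3≤N))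
      where
      2≤n′ : ∀ n → 3 ≤ n * 2 → 2 ≤ n
      2≤n′ 1 (s≤s (s≤s ()))
      2≤n′ (suc (suc _)) _ = s≤s (s≤s z≤n)
    ... | q , qr , divides n″ n′≡n″q = ¬2∣odd h (∣-trans 2∣q (divides n″ n′≡n″q))
      where
      n″2q≡N : n″ * 2 * q ≡ N
      n″2q≡N = trans (lemma n″ q) (trans (cong (_* 2) (sym n′≡n″q)) n′2≡N)
        where
        lemma : ∀ a b → a * 2 * b ≡ a * b * 2
        lemma = solve-∀
      2∣q : 2 ∣ q
      2∣q = p∣Φ⇒p∣q N 2 q (n″ * 2) 2∣Φ n″2q≡N (*>0⇒ˡ>0 (n″ * 2) q (subst (0 <_) (sym n″2q≡N) 0<N))
              (prime⇒≥2 qr) (B-odd⇒2∣F B-odd (n″ * 2))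

  p²∤Φ : ∀ N p n′ → 3 ≤ N → Prime p → p ∣ Φ N B → n′ * p ≡ N → p ∣ F n′ → ¬ p * p ∣ Φ N B
  p²∤Φ N p n′ 3≤N pr p∣Φ n′p≡N p∣Fn′ with even⊎odd p
  ... | inj₂ (h , refl) = odd-p²∤Φ N h n′ (0<h h (prime⇒≥2 pr)) 0<n′ n′p≡N p∣Fn′
    where
    0<n′ : 0 < n′
    0<n′ = *>0⇒ˡ>0 n′ p (subst (0 <_) (sym n′p≡N) (<-trans (s≤s z≤n) 3≤N))
    0<h : ∀ h → 1 < suc (h * 2) → 0 < h
    0<h zero (s≤s ())
    0<h (suc _) _ = s≤s z≤n
  ... | inj₁ (h , p≡h*2) with primes-equal prime[2] pr (divides h p≡h*2)
  ... | refl = 4∤Φ N n′ 3≤N p∣Φ n′p≡N p∣Fn′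

-- Base and modulus are written as successors so that digit's division and remainder compute.
module Digits (a M′ x : ℕ) (x<M : x < suc M′) where

  b : ℕ
  b = suc a
  M : ℕ
  M = suc M′

  open PowerMinusOne b using (F; B^≡1+F; F-*)

  prefix : ℕ → ℕ
  prefix n = x * b ^ n / M

  dig : ℕ → ℕ
  dig i = digit b M x i

  prefix-0 : prefix 0 ≡ 0
  prefix-0 = trans (cong (_/ M) (*-identityʳ x)) (m<n⇒m/n≡0 x<M)

  prefix-suc : ∀ n → prefix (suc n) ≡ prefix n * b + dig (suc n)
  prefix-suc n = begin
      prefix (suc n)                      ≡⟨ m≡m%n+[m/n]*n (prefix (suc n)) b ⟩
      dig (suc n) + prefix (suc n) / b * b ≡⟨ cong (λ z → dig (suc n) + z * b) shift ⟩
      dig (suc n) + prefix n * b          ≡⟨ +-comm (dig (suc n)) _ ⟩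
      prefix n * b + dig (suc n)          ∎
    where
    open ≡-Reasoning
    lemma : ∀ x b y → x * (b * y) ≡ x * y * b
    lemma = solve-∀
    shift : prefix (suc n) / b ≡ prefix n
    shift = begin
      x * b ^ suc n / M / b     ≡⟨ m/n/o≡m/[n*o] (x * b ^ suc n) M b ⟩
      x * b ^ suc n / (M * b)   ≡⟨ /-congˡ {o = M * b} (lemma x b (b ^ n)) ⟩
      x * b ^ n * b / (M * b)   ≡⟨ m*n/o*n≡m/o (x * b ^ n) b M ⟩
      prefix n                  ∎

  chunk : ℕ → ℕ → ℕ
  chunk m K = sum (map (λ t → dig (m + t) * b ^ (K ∸ t)) (range1 K))

  chunk-suc : ∀ m K → chunk m (suc K) ≡ dig (suc m) * b ^ K + chunk (suc m) K
  chunk-suc m K = begin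
      chunk m (suc K)
        ≡⟨ cong (λ ts → sum (map (λ t → dig (m + t) * b ^ (suc K ∸ t)) ts)) range1-suc ⟩
      dig (m + 1) * b ^ K + sum (map (λ t → dig (m + t) * b ^ (suc K ∸ t)) (map suc (range1 K)))
        ≡⟨ cong₂ (λ i ts → dig i * b ^ K + sum ts) (+-comm m 1) (sym (map-∘ (range1 K))) ⟩
      dig (suc m) * b ^ K + sum (map (λ t → dig (m + suc t) * b ^ (K ∸ t)) (range1 K))
        ≡⟨ cong (λ ts → dig (suc m) * b ^ K + sum ts) (map-cong (λ t → cong (λ i → dig i * b ^ (K ∸ t)) (+-suc m t)) (range1 K)) ⟩
      dig (suc m) * b ^ K + chunk (suc m) K
        ∎
    where
    open ≡-Reasoning
    range1-suc : range1 (suc K) ≡ 1 ∷ map suc (range1 K)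
    range1-suc = cong (1 ∷_) (cong (map suc) (sym (map-applyUpTo id suc K)))

  chunk-prefix : ∀ K m → chunk m K + b ^ K * prefix m ≡ prefix (m + K)
  chunk-prefix zero m = trans (+-identityʳ (prefix m)) (cong prefix (sym (+-identityʳ m)))
  chunk-prefix (suc K) m = begin
      chunk m (suc K) + b ^ suc K * prefix m                      ≡⟨ cong (_+ b ^ suc K * prefix m) (chunk-suc m K) ⟩
      dig (suc m) * b ^ K + chunk (suc m) K + b * b ^ K * prefix m ≡⟨ lemma (dig (suc m)) (b ^ K) (chunk (suc m) K) b (prefix m) ⟩
      chunk (suc m) K + b ^ K * (prefix m * b + dig (suc m))      ≡⟨ cong (λ z → chunk (suc m) K + b ^ K * z) (sym (prefix-suc m)) ⟩
      chunk (suc m) K + b ^ K * prefix (suc m)                    ≡⟨ chunk-prefix K (suc m) ⟩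
      prefix (suc m + K)                                          ≡⟨ cong prefix (sym (+-suc m K)) ⟩
      prefix (m + suc K)                                          ∎
    where
    open ≡-Reasoning
    lemma : ∀ d y c b f → d * y + c + b * y * f ≡ c + y * (f * b + d)
    lemma = solve-∀

  module Blocks (k : ℕ) where

    chunks : ℕ → ℕ → ℕ
    chunks m d = sum (map (λ j → chunk (m + j * k) k) (upTo d))

    prefixes : ℕ → ℕ → ℕ
    prefixes m zero = 0
    prefixes m (suc d) = prefix m + prefixes (m + k) d

    chunks-suc : ∀ m d → chunks m (suc d) ≡ chunk (m + 0) k + chunks (m + k) d
    chunks-suc m d = begin
        chunks m (suc d)
          ≡⟨ cong (λ js → sum (map (λ j → chunk (m + j * k) k) js)) upTo-suc ⟩
        chunk (m + 0) k + sum (map (λ j → chunk (m + j * k) k) (map suc (upTo d)))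
          ≡⟨ cong (λ cs → chunk (m + 0) k + sum cs) (sym (map-∘ (upTo d))) ⟩
        chunk (m + 0) k + sum (map (λ j → chunk (m + (k + j * k)) k) (upTo d))
          ≡⟨ cong (λ cs → chunk (m + 0) k + sum cs) (map-cong (λ j → cong (λ i → chunk i k) (sym (+-assoc m k (j * k)))) (upTo d)) ⟩
        chunk (m + 0) k + chunks (m + k) d
          ∎
      where
      open ≡-Reasoning
      upTo-suc : upTo (suc d) ≡ 0 ∷ map suc (upTo d)
      upTo-suc = cong (0 ∷_) (sym (map-applyUpTo id suc d))

    -- Each step uses prefix (m + k) = chunk m k + (1 + F k) * prefix m.
    chunks-prefixes : ∀ d m → chunks m d + F k * prefixes m d + prefix m ≡ prefix (m + d * k)
    chunks-prefixes zero m = trans (cong (_+ prefix m) (*-zeroʳ (F k))) (cong prefix (sym (+-identityʳ m)))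
    chunks-prefixes (suc d) m = begin
        chunks m (suc d) + F k * (prefix m + prefixes (m + k) d) + prefix m
          ≡⟨ cong (λ z → z + F k * (prefix m + prefixes (m + k) d) + prefix m) (chunks-suc m d) ⟩
        chunk (m + 0) k + rest + F k * (prefix m + prefixes (m + k) d) + prefix m
          ≡⟨ lemma (chunk (m + 0) k) rest (F k) (prefix m) (prefixes (m + k) d) ⟩
        (chunk (m + 0) k + suc (F k) * prefix m) + (rest + F k * prefixes (m + k) d)
          ≡⟨ cong₂ (λ i c → (chunk i k + c * prefix m) + (rest + F k * prefixes (m + k) d)) (+-identityʳ m) (sym (B^≡1+F k)) ⟩
        (chunk m k + b ^ k * prefix m) + (rest + F k * prefixes (m + k) d)
          ≡⟨ cong (_+ (rest + F k * prefixes (m + k) d)) (chunk-prefix k m) ⟩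
        prefix (m + k) + (rest + F k * prefixes (m + k) d)
          ≡⟨ trans (+-comm (prefix (m + k)) _) (chunks-prefixes d (m + k)) ⟩
        prefix (m + k + d * k)
          ≡⟨ cong prefix (+-assoc m k (d * k)) ⟩
        prefix (m + suc d * k)
          ∎
      where
      open ≡-Reasoning
      rest = chunks (m + k) d
      lemma : ∀ g t f l h → g + t + f * (l + h) + l ≡ (g + suc f * l) + (t + f * h)
      lemma = solve-∀

    S≡chunks : ∀ d → S b M x k d ≡ chunks 0 d
    S≡chunks d = cong sum (sym (map-∘ (upTo d)))

    -- S ≡ ⌊x b^(dk) / M⌋ (mod b^k - 1), and M r = 1 + b^k + … + b^(k(d-1)) makes the latter (b^k - 1) x r.
    M∣repunit⇒F∣S : ∀ d → M ∣ repunit (b ^ k) d → F k ∣ S b M x k d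
    M∣repunit⇒F∣S d (divides r repunit≡) =
      ∣m+n∣m⇒∣n (subst (F k ∣_) (trans (sym S+F*≡) (+-comm (S b M x k d) _)) (∣m⇒∣m*n (x * r) ∣-refl))
                (∣m⇒∣m*n (prefixes 0 d) ∣-refl)
      where
      open ≡-Reasoning
      S+F*≡prefix : S b M x k d + F k * prefixes 0 d ≡ prefix (d * k)
      S+F*≡prefix = trans (sym (+-identityʳ _))
        (trans (cong₂ (λ s z → s + F k * prefixes 0 d + z) (S≡chunks d) (sym prefix-0)) (chunks-prefixes d 0))
      x*b^dk≡ : x * b ^ (d * k) ≡ F k * (x * r) * M + x
      x*b^dk≡ = begin
        x * b ^ (d * k)               ≡⟨ cong (x *_) (B^≡1+F (d * k)) ⟩
        x * suc (F (d * k))           ≡⟨ cong (λ z → x * suc (F z)) (*-comm d k) ⟩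
        x * suc (F (k * d))           ≡⟨ cong (λ z → x * suc z) (F-* k d) ⟩
        x * suc (F k * repunit (b ^ k) d) ≡⟨ cong (λ z → x * suc (F k * z)) repunit≡ ⟩
        x * suc (F k * (r * M))       ≡⟨ lemma x (F k) r M ⟩
        F k * (x * r) * M + x         ∎
        where
        lemma : ∀ x f r m → x * suc (f * (r * m)) ≡ f * (x * r) * m + x
        lemma = solve-∀
      S+F*≡ : S b M x k d + F k * prefixes 0 d ≡ F k * (x * r)
      S+F*≡ = begin
        S b M x k d + F k * prefixes 0 d   ≡⟨ S+F*≡prefix ⟩
        x * b ^ (d * k) / M                ≡⟨ cong (_/ M) x*b^dk≡ ⟩
        (F k * (x * r) * M + x) / M        ≡⟨ +-distrib-/ (F k * (x * r) * M) x remainders<M ⟩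
        F k * (x * r) * M / M + x / M      ≡⟨ cong₂ _+_ (m*n/n≡m (F k * (x * r)) M) (m<n⇒m/n≡0 x<M) ⟩
        F k * (x * r) + 0                  ≡⟨ +-identityʳ _ ⟩
        F k * (x * r)                      ∎
        where
        remainders<M : F k * (x * r) * M % M + x % M < M
        remainders<M = subst (λ z → z + x % M < M) (sym (m*n%n≡0 (F k * (x * r)) M)) (m%n<n x M)

module MidyNumberFromΦ (a N : ℕ) (2<N : 2 < N) where

  B : ℕ
  B = suc (suc a)

  open PrimeDivisorsOfΦ B (s≤s (s≤s z≤n))

  0<N : 0 < N
  0<N = <-trans (s≤s z≤n) 2<N

  M : ℕ
  M = fN N B
  g : ℕ
  g = gcd N (Φ N B)

  M*g≡Φ : M * g ≡ Φ N B
  M*g≡Φ = exact g (gcd>0 N (Φ N B) 0<N) (gcd[m,n]∣n N (Φ N B))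
    where
    exact : ∀ g → 0 < g → g ∣ Φ N B → (Φ N B /′ g) * g ≡ Φ N B
    exact (suc _) _ g∣Φ = m/n*n≡m g∣Φ

  M∣Φ : M ∣ Φ N B
  M∣Φ = divides g (trans (sym M*g≡Φ) (*-comm M g))

  M∣F : M ∣ F N
  M∣F = ∣-trans M∣Φ (Φ∣F N 0<N)

  -- A prime p ∣ M dividing some b^k - 1 with k < N would divide N and exactly divide Φ_N(b),
  -- hence divide g = gcd (N, Φ_N(b)) and so p² ∣ M g.
  prime∣M⇒∤F : ∀ p → Prime p → p ∣ M → ∀ k → 0 < k → k < N → ¬ p ∣ F k
  prime∣M⇒∤F p pr p∣M k 0<k k<N p∣Fk = p²∣Φ-impossible (p∣Φ⇒p∣N N p k pr p∣Φ 0<k k<N p∣Fk)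
    where
    p∣Φ : p ∣ Φ N B
    p∣Φ = ∣-trans p∣M M∣Φ
    p²∣Φ-impossible : ∃[ n′ ] (n′ * p ≡ N × p ∣ F n′) → ⊥
    p²∣Φ-impossible (n′ , n′p≡N , p∣Fn′) = p²∤Φ N p n′ 2<N pr p∣Φ n′p≡N p∣Fn′
      (subst (p * p ∣_) M*g≡Φ (*-pres-∣ p∣M (gcd-greatest (divides n′ (sym n′p≡N)) p∣Φ)))

  M-coprime-B : Coprime M B
  M-coprime-B {c} (c∣M , c∣B) = ∣1⇒≡1 (∣m+n∣m⇒∣n c∣F+1 (∣-trans c∣M M∣F))
    where
    B∣B^N : ∀ n → 0 < n → B ∣ B ^ n
    B∣B^N (suc n) _ = m∣m*n (B ^ n)
    c∣F+1 : c ∣ F N + 1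
    c∣F+1 = subst (c ∣_) (trans (B^≡1+F N) (+-comm 1 (F N))) (∣-trans c∣B (B∣B^N N 0<N))

  prime∣M⇒N<p : ∀ p → Prime p → p ∣ M → N < p
  prime∣M⇒N<p p pr p∣M with prime∤B⇒prime∣F p pr (λ p∣B → <⇒≢ (prime⇒≥2 pr) (sym (M-coprime-B (p∣M , p∣B))))
  ... | k , 0<k , k<p , p∣Fk with k <? N
  ...   | yes k<N = ⊥-elim (prime∣M⇒∤F p pr p∣M k 0<k k<N p∣Fk)
  ...   | no k≮N = ≤-<-trans (≮⇒≥ k≮N) k<p

  M-odd : ¬ 2 ∣ M
  M-odd 2∣M = <-asym 2<N (prime∣M⇒N<p 2 prime[2] 2∣M)

  M-coprime-N : 0 < M → Coprime M N
  M-coprime-N 0<M = coprime-by-primes M N 0<M λ p pr p∣M p∣N →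
    <⇒≱ (prime∣M⇒N<p p pr p∣M) (∣⇒≤ {{>-nonZero 0<N}} p∣N)

  M-coprime-F : 0 < M → ∀ k → 0 < k → k < N → Coprime M (F k)
  M-coprime-F 0<M k 0<k k<N = coprime-by-primes M (F k) 0<M λ p pr p∣M → prime∣M⇒∤F p pr p∣M k 0<k k<N

  module _ (M-composite : Composite M) where

    2≤M : 2 ≤ M
    2≤M = nonTrivial⇒n>1 M {{composite⇒nonTrivial M-composite}}

    0<M : 0 < M
    0<M = <-trans (s≤s z≤n) 2≤M

    M-order : IsOrder B M N
    M-order = 0<N , M∣F , λ m 0<m m<N M∣Fm → not-below m 0<m m<N M∣Fm (prime-divisor M 2≤M)
      where
      not-below : ∀ m → 0 < m → m < N → M ∣ F m → ∃[ q ] (Prime q × q ∣ M) → ⊥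
      not-below m 0<m m<N M∣Fm (q , qr , q∣M) = prime∣M⇒∤F q qr q∣M m 0<m m<N (∣-trans q∣M M∣Fm)

    M-midy : ∀ d → d ∣ N → 1 < d → HasMidy B M N d
    M-midy d _ 1<d k k*d≡N x _ x<M _ = F∣S M x<M M∣repunit
      where
      0<k : 0 < k
      0<k = *>0⇒ˡ>0 k d (subst (0 <_) (sym k*d≡N) 0<N)
      k<N : k < N
      k<N = subst (k <_) k*d≡N (m<m*n k d {{>-nonZero 0<k}} 1<d)
      M∣repunit : M ∣ repunit (B ^ k) d
      M∣repunit = coprime-divisor (M-coprime-F 0<M k 0<k k<N)
                    (subst (M ∣_) (trans (cong F (sym k*d≡N)) (F-* k d)) M∣F)
      F∣S : ∀ M → x < M → M ∣ repunit (B ^ k) d → F k ∣ S B M x k d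
      F∣S (suc M′) x<M = Digits.Blocks.M∣repunit⇒F∣S (suc a) M′ x x<M k d

    midy-number : MidyNumber B M
    midy-number = M-odd , M-composite , M-coprime-B , N , M-order , M-coprime-N 0<M , M-midy

mainTheorem1 : ∀ (N b : ℕ) → 2 < N → 2 ≤ b → Composite (fN N b) → MidyNumber b (fN N b)
mainTheorem1 N (suc (suc a)) 2<N (s≤s (s≤s z≤n)) = MidyNumberFromΦ.midy-number a N 2<N
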